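{- Let $\phi$ be a second-order sentence over the vocabulary $\{\le\}\cup\{P_i\mid p_i\in\mathrm{AP}\}$. Then there exists a formula $\mathrm{Tr}'(\phi)(R_T)$ of second-order arithmetic ($\Delta^2_0$), with a free 4-ary relation variable $R_T$, such that for all countable trace sets $T$ (with an enumeration $T=(t_i)_{i\in I}$ as below): $$\mathcal M_T\models\phi\iff(\mathbb N,+,\times,\le,0,1)\models\mathrm{Tr}'(\phi)(A_T/R_T).$$
   Context: $\mathrm{AP}=\{p_0,p_1,\dots\}$; a trace is $t\in(2^{\mathrm{AP}})^\omega$, a trace set is a set of traces. $\mathcal M_T$ has domain $T\times\mathbb N$, $(t,n)\le(t',m)$ iff $t=t'$ and $n\le m$, and $P_i=\{(t,j)\mid p_i\in t(j)\}$. $\Delta^2_0$ denotes the set of second-order formulas over $\{+,\times,0,1,=,\le\}$, interpreted in the standard model of arithmetic. A countable trace set is written $T=\{t_i\mid i\in I\}$ with $I=\mathbb N$ or $I=\{0,\dots,n\}$ (distinct indices giving distinct traces). Its encoding $A_T\subseteq\mathbb N^4$ consists of the tuples $(0,i,j,k)$ with $p_k\in t_i(j)$, together with the tuple $(1,n,n,n)$ where $n=|T|$, in case $T$ is finite. -}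

module Defs where

open import Level using (Lift; lift) renaming (suc to lsuc; zero to lzero)
open import Data.Nat using (ℕ; zero; suc; _≤_) renaming (_+_ to _+ℕ_; _*_ to _*ℕ_)
open import Data.Bool using (Bool; true)
open import Data.Fin using (Fin; toℕ)
open import Data.Vec using (Vec; []; _∷_; lookup) renaming (map to vmap)
open import Data.List using (List; []; _∷_)
open import Data.List.Membership.Propositional using (_∈_)
open import Data.List.Relation.Unary.All using (All) renaming (lookup to alookup)
open import Data.Product using (Σ; _×_; _,_; proj₁; proj₂)
open import Data.Sum using (_⊎_)
open import Relation.Nullary using (¬_)
open import Relation.Binary.PropositionalEquality using (_≡_)

-- AP = {p_0, p_1, ...}.  A trace t ∈ (2^AP)^ω is represented by
-- t j k = true  iff  p_k ∈ t(j).
Trace : Set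
Trace = ℕ → ℕ → Bool

-- Index set I of an enumeration: finite with n elements, or ℕ.
data Card : Set where
  fin : ℕ → Card
  inf : Card

Idx : Card → Set
Idx (fin n) = Fin n
Idx inf     = ℕ

idx→ℕ : (c : Card) → Idx c → ℕ
idx→ℕ (fin n) i = toℕ i
idx→ℕ inf     i = i

DistinctTraces : (c : Card) → (Idx c → Trace) → Set
DistinctTraces c t = ∀ i i' → (∀ j k → t i j k ≡ t i' j k) → i ≡ i'

-- Domain of M_T: T × ℕ, with T identified with its index set.
Dom : Card → Set
Dom c = Idx c × ℕ

Rel : Set → ℕ → Set₁
Rel D k = Vec D k → Set

REnv : Set → List ℕ → Set₁
REnv D Γ = All (Rel D) Γ

-- Second-order logic over {≤} ∪ {P_i}  (n first-order variables in
-- scope, Γ = arities of second-order variables in scope; de Bruijn)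

data TFormula (n : ℕ) (Γ : List ℕ) : Set where
  _≤ₜ_ : Fin n → Fin n → TFormula n Γ
  _≐ₜ_ : Fin n → Fin n → TFormula n Γ
  Pₜ    : ℕ → Fin n → TFormula n Γ
  relₜ  : {k : ℕ} → k ∈ Γ → Vec (Fin n) k → TFormula n Γ
  ¬ₜ_   : TFormula n Γ → TFormula n Γ
  _∧ₜ_ : TFormula n Γ → TFormula n Γ → TFormula n Γ
  _∨ₜ_ : TFormula n Γ → TFormula n Γ → TFormula n Γ
  _⇒ₜ_ : TFormula n Γ → TFormula n Γ → TFormula n Γ
  ∃ₜ    : TFormula (suc n) Γ → TFormula n Γ
  ∀ₜ    : TFormula (suc n) Γ → TFormula n Γ
  ∃²ₜ   : (k : ℕ) → TFormula n (k ∷ Γ) → TFormula n Γ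
  ∀²ₜ   : (k : ℕ) → TFormula n (k ∷ Γ) → TFormula n Γ

TSentence : Set
TSentence = TFormula 0 []

SatT : {n : ℕ} {Γ : List ℕ} (c : Card) (t : Idx c → Trace) →
       TFormula n Γ → Vec (Dom c) n → REnv (Dom c) Γ → Set₁
SatT c t (x ≤ₜ y) ρ σ = Lift (lsuc lzero)
  ((proj₁ (lookup ρ x) ≡ proj₁ (lookup ρ y)) × (proj₂ (lookup ρ x) ≤ proj₂ (lookup ρ y)))
SatT c t (x ≐ₜ y) ρ σ = Lift (lsuc lzero) (lookup ρ x ≡ lookup ρ y)
SatT c t (Pₜ k x) ρ σ = Lift (lsuc lzero) (t (proj₁ (lookup ρ x)) (proj₂ (lookup ρ x)) k ≡ true)
SatT c t (relₜ X xs) ρ σ = Lift (lsuc lzero) (alookup σ X (vmap (lookup ρ) xs))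
SatT c t (¬ₜ φ) ρ σ = ¬ SatT c t φ ρ σ
SatT c t (φ ∧ₜ ψ) ρ σ = SatT c t φ ρ σ × SatT c t ψ ρ σ
SatT c t (φ ∨ₜ ψ) ρ σ = SatT c t φ ρ σ ⊎ SatT c t ψ ρ σ
SatT c t (φ ⇒ₜ ψ) ρ σ = SatT c t φ ρ σ → SatT c t ψ ρ σ
SatT c t (∃ₜ φ) ρ σ = Σ (Dom c) λ d → SatT c t φ (d ∷ ρ) σ
SatT c t (∀ₜ φ) ρ σ = (d : Dom c) → SatT c t φ (d ∷ ρ) σ
SatT c t (∃²ₜ k φ) ρ σ = Σ (Rel (Dom c) k) λ R → SatT c t φ ρ (All._∷_ R σ)
  where open import Data.List.Relation.Unary.All as All
SatT c t (∀²ₜ k φ) ρ σ = (R : Rel (Dom c) k) → SatT c t φ ρ (All._∷_ R σ)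
  where open import Data.List.Relation.Unary.All as All

data ATerm (n : ℕ) : Set where
  var  : Fin n → ATerm n
  zeroA : ATerm n
  oneA  : ATerm n
  _+A_ : ATerm n → ATerm n → ATerm n
  _*A_ : ATerm n → ATerm n → ATerm n

data AFormula (n : ℕ) (Γ : List ℕ) : Set where
  _≐A_ : ATerm n → ATerm n → AFormula n Γ
  _≤A_ : ATerm n → ATerm n → AFormula n Γ
  relA  : {k : ℕ} → k ∈ Γ → Vec (ATerm n) k → AFormula n Γ
  ¬A_   : AFormula n Γ → AFormula n Γ
  _∧A_ : AFormula n Γ → AFormula n Γ → AFormula n Γ
  _∨A_ : AFormula n Γ → AFormula n Γ → AFormula n Γ
  _⇒A_ : AFormula n Γ → AFormula n Γ → AFormula n Γ
  ∃A    : AFormula (suc n) Γ → AFormula n Γ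
  ∀A    : AFormula (suc n) Γ → AFormula n Γ
  ∃²A   : (k : ℕ) → AFormula n (k ∷ Γ) → AFormula n Γ
  ∀²A   : (k : ℕ) → AFormula n (k ∷ Γ) → AFormula n Γ

evalA : {n : ℕ} → ATerm n → Vec ℕ n → ℕ
evalA (var x) ρ = lookup ρ x
evalA zeroA ρ = 0
evalA oneA ρ = 1
evalA (a +A b) ρ = evalA a ρ +ℕ evalA b ρ
evalA (a *A b) ρ = evalA a ρ *ℕ evalA b ρ

-- Satisfaction in the standard model (ℕ, +, ×, ≤, 0, 1), full
-- second-order semantics (relations = arbitrary predicates on ℕ^k).
SatA : {n : ℕ} {Γ : List ℕ} → AFormula n Γ → Vec ℕ n → REnv ℕ Γ → Set₁
SatA (a ≐A b) ρ σ = Lift (lsuc lzero) (evalA a ρ ≡ evalA b ρ)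
SatA (a ≤A b) ρ σ = Lift (lsuc lzero) (evalA a ρ ≤ evalA b ρ)
SatA (relA X as) ρ σ = Lift (lsuc lzero) (alookup σ X (vmap (λ a → evalA a ρ) as))
SatA (¬A φ) ρ σ = ¬ SatA φ ρ σ
SatA (φ ∧A ψ) ρ σ = SatA φ ρ σ × SatA ψ ρ σ
SatA (φ ∨A ψ) ρ σ = SatA φ ρ σ ⊎ SatA ψ ρ σ
SatA (φ ⇒A ψ) ρ σ = SatA φ ρ σ → SatA ψ ρ σ
SatA (∃A φ) ρ σ = Σ ℕ λ m → SatA φ (m ∷ ρ) σ
SatA (∀A φ) ρ σ = (m : ℕ) → SatA φ (m ∷ ρ) σ
SatA (∃²A k φ) ρ σ = Σ (Rel ℕ k) λ R → SatA φ ρ (All._∷_ R σ)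
  where open import Data.List.Relation.Unary.All as All
SatA (∀²A k φ) ρ σ = (R : Rel ℕ k) → SatA φ ρ (All._∷_ R σ)
  where open import Data.List.Relation.Unary.All as All

data EncT (c : Card) (t : Idx c → Trace) : Vec ℕ 4 → Set where
  enc-trace : (i : Idx c) (j k : ℕ) → t i j k ≡ true →
              EncT c t (0 ∷ idx→ℕ c i ∷ j ∷ k ∷ [])
  enc-size  : (n : ℕ) → c ≡ fin n → EncT c t (1 ∷ n ∷ n ∷ n ∷ [])

AFormulaR : Set
AFormulaR = AFormula 0 (4 ∷ [])

SatEnc : AFormulaR → (c : Card) → (Idx c → Trace) → Set₁
SatEnc ψ c t = SatA ψ [] (All._∷_ (EncT c t) All.[])
  where open import Data.List.Relation.Unary.All as All

ModelsT : (c : Card) → (Idx c → Trace) → TSentence → Set₁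
ModelsT c t φ = SatT c t φ [] All.[]
  where open import Data.List.Relation.Unary.All as All

-- The point (t_i, j) of M_T is coded by the pair of numbers (i, j), and a k-ary relation
-- on M_T by a 2k-ary relation on ℕ. Atomic formulas are then read off A_T, and a quantifier
-- over M_T becomes a quantifier over pairs whose first entry is a genuine index; this is
-- definable from A_T, since a number indexes a trace iff it lies below every n with
-- (1,n,n,n) ∈ A_T (vacuously so when T is infinite). Second-order quantifiers carry over
-- because a relation on codes restricts to one on M_T, and a relation on M_T is the
-- restriction of its image under the injective coding.
module Submission where

open import Defs
open import Level using (Level; Lift; lift; lower)
open import Data.Nat using (ℕ; zero; suc; _<_)
open import Data.Bool using (true)
open import Data.Fin using (Fin; fromℕ<) renaming (zero to fzero; suc to fsuc)
open import Data.Fin.Properties using (toℕ-injective; toℕ<n; toℕ-fromℕ<)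
open import Data.Vec using (Vec; []; _∷_; lookup) renaming (map to vmap)
open import Data.Vec.Properties using (∷-injective)
open import Data.List using (List; []; _∷_)
open import Data.List.Membership.Propositional using (_∈_)
open import Data.List.Relation.Unary.Any using (here; there)
open import Data.List.Relation.Unary.All using ([]; _∷_) renaming (lookup to alookup)
open import Data.Product using (Σ; _×_; _,_; proj₁; proj₂)
open import Data.Product.Function.NonDependent.Propositional using (_×-⇔_)
open import Data.Sum.Function.Propositional using (_⊎-⇔_)
open import Function using (id; _∘_; _⇔_; mk⇔; Equivalence)
open import Function.Construct.Composition using (_⇔-∘_)
open import Function.Related.TypeIsomorphisms using (→-cong-⇔; ¬-cong-⇔)
open import Function.Construct.Identity using (⇔-id)
open import Relation.Binary.PropositionalEquality using (_≡_; refl; cong; cong₂; subst)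

open Equivalence using (to; from)

private variable
  n k : ℕ
  Γ : List ℕ

double : ℕ → ℕ
double zero    = zero
double (suc n) = suc (suc (double n))

indexVar positionVar : Fin n → Fin (double n)
indexVar fzero    = fzero
indexVar (fsuc x) = fsuc (fsuc (indexVar x))
positionVar fzero    = fsuc fzero
positionVar (fsuc x) = fsuc (fsuc (positionVar x))

codeVars : Vec (Fin n) k → Vec (ATerm (double n)) (double k)
codeVars []       = []
codeVars (x ∷ xs) = var (indexVar x) ∷ var (positionVar x) ∷ codeVars xs

codeCtx : List ℕ → List ℕ
codeCtx []      = 4 ∷ []
codeCtx (k ∷ Γ) = double k ∷ codeCtx Γ

∈-codeCtx : k ∈ Γ → double k ∈ codeCtx Γ
∈-codeCtx (here refl) = here refl
∈-codeCtx (there X)   = there (∈-codeCtx X)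

encodingVar : (Γ : List ℕ) → 4 ∈ codeCtx Γ
encodingVar []      = here refl
encodingVar (k ∷ Γ) = there (encodingVar Γ)

numeral : ℕ → ATerm n
numeral zero    = zeroA
numeral (suc k) = oneA +A numeral k

evalA-numeral : (k : ℕ) (ρ : Vec ℕ n) → evalA (numeral k) ρ ≡ k
evalA-numeral zero    ρ = refl
evalA-numeral (suc k) ρ = cong suc (evalA-numeral k ρ)

isIndex : Fin n → AFormula n (codeCtx Γ)
isIndex {Γ = Γ} x =
  ∀A (relA (encodingVar Γ) (oneA ∷ var fzero ∷ var fzero ∷ var fzero ∷ [])
      ⇒A ((oneA +A var (fsuc x)) ≤A var fzero))

translate : TFormula n Γ → AFormula (double n) (codeCtx Γ)
translate (x ≤ₜ y) =
  (var (indexVar x) ≐A var (indexVar y)) ∧A (var (positionVar x) ≤A var (positionVar y))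
translate (x ≐ₜ y) =
  (var (indexVar x) ≐A var (indexVar y)) ∧A (var (positionVar x) ≐A var (positionVar y))
translate {Γ = Γ} (Pₜ k x) =
  relA (encodingVar Γ) (zeroA ∷ var (indexVar x) ∷ var (positionVar x) ∷ numeral k ∷ [])
translate (relₜ X xs) = relA (∈-codeCtx X) (codeVars xs)
translate (¬ₜ φ)      = ¬A translate φ
translate (φ ∧ₜ ψ)    = translate φ ∧A translate ψ
translate (φ ∨ₜ ψ)    = translate φ ∨A translate ψ
translate (φ ⇒ₜ ψ)    = translate φ ⇒A translate ψ
translate (∃ₜ φ)      = ∃A (∃A (isIndex fzero ∧A translate φ))
translate (∀ₜ φ)      = ∀A (∀A (isIndex fzero ⇒A translate φ))
translate (∃²ₜ k φ)   = ∃²A (double k) (translate φ)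
translate (∀²ₜ k φ)   = ∀²A (double k) (translate φ)

idx→ℕ-injective : (c : Card) {i i' : Idx c} → idx→ℕ c i ≡ idx→ℕ c i' → i ≡ i'
idx→ℕ-injective (fin n) = toℕ-injective
idx→ℕ-injective inf     = id

trace⇔EncT : (c : Card) (t : Idx c → Trace) {i : Idx c} {j k : ℕ} →
             (t i j k ≡ true) ⇔ EncT c t (0 ∷ idx→ℕ c i ∷ j ∷ k ∷ [])
trace⇔EncT c t = mk⇔ (enc-trace _ _ _) (λ e → decode e refl)
  where
  decode : {i : Idx c} {a j k : ℕ} →
           EncT c t (0 ∷ a ∷ j ∷ k ∷ []) → idx→ℕ c i ≡ a → t i j k ≡ true
  decode (enc-trace i' j k e) eq with idx→ℕ-injective c eq
  ... | refl = e

EncT-size-bound : (c : Card) (t : Idx c → Trace) {m : ℕ} → EncT c t (1 ∷ m ∷ m ∷ m ∷ []) →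
                  (i : Idx c) → idx→ℕ c i < m
EncT-size-bound .(fin n) t (enc-size n refl) i = toℕ<n i

EncT-bounds⇔index : (c : Card) (t : Idx c → Trace) {a : ℕ} →
  ((m : ℕ) → EncT c t (1 ∷ m ∷ m ∷ m ∷ []) → a < m) ⇔ Σ (Idx c) (λ i → idx→ℕ c i ≡ a)
EncT-bounds⇔index (fin n) t =
  mk⇔ (λ below → fromℕ< (below n (enc-size n refl)) , toℕ-fromℕ< _)
      (λ { (i , refl) m e → EncT-size-bound (fin n) t e i })
EncT-bounds⇔index inf t =
  mk⇔ (λ _ → _ , refl) (λ { (i , refl) m e → EncT-size-bound inf t e i })

Lift-cong : {a ℓ : Level} {A B : Set a} → A ⇔ B → Lift ℓ A ⇔ Lift ℓ B
Lift-cong A⇔B = mk⇔ (λ (lift x) → lift (to A⇔B x)) (λ (lift y) → lift (from A⇔B y))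

module Coding (c : Card) (t : Idx c → Trace) where

  code : Vec (Dom c) n → Vec ℕ (double n)
  code []             = []
  code ((i , j) ∷ ds) = idx→ℕ c i ∷ j ∷ code ds

  code-injective : {ds ds' : Vec (Dom c) n} → code ds ≡ code ds' → ds ≡ ds'
  code-injective {ds = []}    {[]}     _ = refl
  code-injective {ds = _ ∷ _} {_ ∷ _} e with ∷-injective e
  ... | eᵢ , e′ with ∷-injective e′
  ... | eⱼ , e″ = cong₂ _∷_ (cong₂ _,_ (idx→ℕ-injective c eᵢ) eⱼ) (code-injective e″)

  lookup-code-index : (ds : Vec (Dom c) n) (x : Fin n) →
                      lookup (code ds) (indexVar x) ≡ idx→ℕ c (proj₁ (lookup ds x))
  lookup-code-index (d ∷ ds) fzero    = refl
  lookup-code-index (d ∷ ds) (fsuc x) = lookup-code-index ds x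

  lookup-code-position : (ds : Vec (Dom c) n) (x : Fin n) →
                         lookup (code ds) (positionVar x) ≡ proj₂ (lookup ds x)
  lookup-code-position (d ∷ ds) fzero    = refl
  lookup-code-position (d ∷ ds) (fsuc x) = lookup-code-position ds x

  evalA-codeVars : (ρ : Vec (Dom c) n) (xs : Vec (Fin n) k) →
                   vmap (λ a → evalA a (code ρ)) (codeVars xs) ≡ code (vmap (lookup ρ) xs)
  evalA-codeVars ρ []       = refl
  evalA-codeVars ρ (x ∷ xs) =
    cong₂ _∷_ (lookup-code-index ρ x) (cong₂ _∷_ (lookup-code-position ρ x) (evalA-codeVars ρ xs))

  codeRel : Rel (Dom c) k → Rel ℕ (double k)
  codeRel X v = Σ (Vec (Dom c) _) λ ds → code ds ≡ v × X ds

  codeRel-correct : (X : Rel (Dom c) k) (ds : Vec (Dom c) k) → X ds ⇔ codeRel X (code ds)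
  codeRel-correct X ds =
    mk⇔ (λ x → ds , refl , x) (λ (ds' , e , x) → subst X (code-injective e) x)

  infix 4 _≈_
  data _≈_ : REnv (Dom c) Γ → REnv ℕ (codeCtx Γ) → Set₁ where
    encoding : {R : Rel ℕ 4} → (∀ v → EncT c t v ⇔ R v) → [] ≈ R ∷ []
    _∷_      : {X : Rel (Dom c) k} {Y : Rel ℕ (double k)}
               {σ : REnv (Dom c) Γ} {σ' : REnv ℕ (codeCtx Γ)} →
               (∀ ds → X ds ⇔ Y (code ds)) → σ ≈ σ' → X ∷ σ ≈ Y ∷ σ'

  lookup-encodingVar : {σ : REnv (Dom c) Γ} {σ' : REnv ℕ (codeCtx Γ)} → σ ≈ σ' →
                       ∀ v → EncT c t v ⇔ alookup σ' (encodingVar Γ) v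
  lookup-encodingVar (encoding R⇔) = R⇔
  lookup-encodingVar (_ ∷ σ≈σ')    = lookup-encodingVar σ≈σ'

  lookup-≈ : {σ : REnv (Dom c) Γ} {σ' : REnv ℕ (codeCtx Γ)} → σ ≈ σ' →
             (X : k ∈ Γ) → ∀ ds → alookup σ X ds ⇔ alookup σ' (∈-codeCtx X) (code ds)
  lookup-≈ (X⇔Y ∷ _)  (here refl) = X⇔Y
  lookup-≈ (_ ∷ σ≈σ') (there X)   = lookup-≈ σ≈σ' X

  isIndex-correct : {σ : REnv (Dom c) Γ} {σ' : REnv ℕ (codeCtx Γ)} → σ ≈ σ' →
                    (ρ' : Vec ℕ n) (x : Fin n) →
                    SatA (isIndex {Γ = Γ} x) ρ' σ' ⇔ Σ (Idx c) (λ i → idx→ℕ c i ≡ lookup ρ' x)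
  isIndex-correct σ≈σ' ρ' x = mk⇔
    (λ below → to (EncT-bounds⇔index c t) λ m e → lower (below m (lift (to (R⇔ _) e))))
    (λ index m (lift r) → lift (from (EncT-bounds⇔index c t) index m (from (R⇔ _) r)))
    where R⇔ = lookup-encodingVar σ≈σ'

  isIndex-idx→ℕ : {σ : REnv (Dom c) Γ} {σ' : REnv ℕ (codeCtx Γ)} → σ ≈ σ' →
                  (i : Idx c) (ρ' : Vec ℕ n) →
                  SatA (isIndex {Γ = Γ} fzero) (idx→ℕ c i ∷ ρ') σ'
  isIndex-idx→ℕ σ≈σ' i ρ' = from (isIndex-correct σ≈σ' (idx→ℕ c i ∷ ρ') fzero) (i , refl)

  index-elim : {σ : REnv (Dom c) Γ} {σ' : REnv ℕ (codeCtx Γ)} → σ ≈ σ' →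
               (P : ℕ → Set₁) {a : ℕ} (ρ' : Vec ℕ n) →
               SatA (isIndex {Γ = Γ} fzero) (a ∷ ρ') σ' → ((i : Idx c) → P (idx→ℕ c i)) → P a
  index-elim σ≈σ' P {a} ρ' isIdx p with to (isIndex-correct σ≈σ' (a ∷ ρ') fzero) isIdx
  ... | i , refl = p i

  translate-correct : (φ : TFormula n Γ) (ρ : Vec (Dom c) n)
                      {σ : REnv (Dom c) Γ} {σ' : REnv ℕ (codeCtx Γ)} → σ ≈ σ' →
                      SatT c t φ ρ σ ⇔ SatA (translate φ) (code ρ) σ'
  translate-correct (x ≤ₜ y) ρ _
    rewrite lookup-code-index ρ x | lookup-code-index ρ y
          | lookup-code-position ρ x | lookup-code-position ρ y =
    mk⇔ (λ (lift (e , le)) → lift (cong (idx→ℕ c) e) , lift le)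
        (λ (lift e , lift le) → lift (idx→ℕ-injective c e , le))
  translate-correct (x ≐ₜ y) ρ _
    rewrite lookup-code-index ρ x | lookup-code-index ρ y
          | lookup-code-position ρ x | lookup-code-position ρ y =
    mk⇔ (λ (lift e) → lift (cong (idx→ℕ c ∘ proj₁) e) , lift (cong proj₂ e))
        (λ (lift eᵢ , lift eⱼ) → lift (cong₂ _,_ (idx→ℕ-injective c eᵢ) eⱼ))
  translate-correct (Pₜ k x) ρ σ≈σ'
    rewrite lookup-code-index ρ x | lookup-code-position ρ x | evalA-numeral k (code ρ) =
    Lift-cong (lookup-encodingVar σ≈σ' _ ⇔-∘ trace⇔EncT c t)
  translate-correct (relₜ X xs) ρ σ≈σ' rewrite evalA-codeVars ρ xs =
    Lift-cong (lookup-≈ σ≈σ' X _)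
  translate-correct (¬ₜ φ)   ρ σ≈σ' = ¬-cong-⇔ (translate-correct φ ρ σ≈σ')
  translate-correct (φ ∧ₜ ψ) ρ σ≈σ' = translate-correct φ ρ σ≈σ' ×-⇔ translate-correct ψ ρ σ≈σ'
  translate-correct (φ ∨ₜ ψ) ρ σ≈σ' = translate-correct φ ρ σ≈σ' ⊎-⇔ translate-correct ψ ρ σ≈σ'
  translate-correct (φ ⇒ₜ ψ) ρ σ≈σ' =
    →-cong-⇔ (translate-correct φ ρ σ≈σ') (translate-correct ψ ρ σ≈σ')
  translate-correct (∃ₜ φ) ρ σ≈σ' = mk⇔
    (λ ((i , j) , s) → j , idx→ℕ c i , isIndex-idx→ℕ σ≈σ' i (j ∷ code ρ) ,
                       to (translate-correct φ ((i , j) ∷ ρ) σ≈σ') s)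
    (λ (j , a , isIdx , s) →
       index-elim σ≈σ' (λ a → SatA (translate φ) (a ∷ j ∷ code ρ) _ → SatT c t (∃ₜ φ) ρ _)
         (j ∷ code ρ) isIdx (λ i s → (i , j) , from (translate-correct φ ((i , j) ∷ ρ) σ≈σ') s) s)
  translate-correct (∀ₜ φ) ρ σ≈σ' = mk⇔
    (λ h j a isIdx →
       index-elim σ≈σ' (λ a → SatA (translate φ) (a ∷ j ∷ code ρ) _) (j ∷ code ρ) isIdx
         (λ i → to (translate-correct φ ((i , j) ∷ ρ) σ≈σ') (h (i , j))))
    (λ h (i , j) → from (translate-correct φ ((i , j) ∷ ρ) σ≈σ')
                     (h j (idx→ℕ c i) (isIndex-idx→ℕ σ≈σ' i (j ∷ code ρ))))
  translate-correct (∃²ₜ k φ) ρ σ≈σ' = mk⇔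
    (λ (X , s) → codeRel X , to (translate-correct φ ρ (codeRel-correct X ∷ σ≈σ')) s)
    (λ (Y , s) → (λ ds → Y (code ds)) , from (translate-correct φ ρ ((λ _ → ⇔-id _) ∷ σ≈σ')) s)
  translate-correct (∀²ₜ k φ) ρ σ≈σ' = mk⇔
    (λ h Y → to (translate-correct φ ρ ((λ _ → ⇔-id _) ∷ σ≈σ')) (h (λ ds → Y (code ds))))
    (λ h X → from (translate-correct φ ρ (codeRel-correct X ∷ σ≈σ')) (h (codeRel X)))

theorem5 : (φ : TSentence) →
    Σ AFormulaR (λ ψ →
      (c : Card) (t : Idx c → Trace) → DistinctTraces c t →
        (ModelsT c t φ → SatEnc ψ c t) × (SatEnc ψ c t → ModelsT c t φ))
theorem5 φ = translate φ , λ c t _ →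
  let open Coding c t
      M⇔A = translate-correct φ [] (encoding (λ _ → ⇔-id _))
  in to M⇔A , from M⇔A
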